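{- Let $q=p^n$ with $p$ prime, let $d+1$ be a divisor of $q-1$, and let $f:\mathbb{F}_q\to\mathbb{F}_q$ be a $(d+1)$-divisible Dembowski-Ostrom polynomial which is almost-$(d+1)$-to-1. Then (a) $f$ is zero-difference $d$-balanced; (b) $f$ is differentially $d$-uniform and all its differential sets $D_a(f)$, $a\neq 0$, are $\mathbb{F}_p$-linear subspaces of $\mathbb{F}_q$; (c) $d=p^i$ for some integer $i\geq 0$.
   Context: A polynomial $f\in\mathbb{F}_q[x]$, $q=p^n$, is Dembowski-Ostrom (DO) if it can be written as $f(x)=\sum_{i,j=0}^{n-1}a_{ij}x^{p^i+p^j}$ when $q$ is odd, and as $f(x)=\sum_{i,j=0,\, i\neq j}^{n-1}a_{ij}x^{2^i+2^j}$ when $q$ is even. For a divisor $k$ of $q-1$, a map $f$ is $k$-divisible if $f(x)=f'(x^k)$ for some map $f'$. A map $f$ is almost-$k$-to-1 if there is a unique element of $\mathrm{Im}(f)$ with exactly one preimage and every other element of $\mathrm{Im}(f)$ has exactly $k$ preimages. $f$ is (differentially) $d$-uniform if $d=\max_{a\neq 0,\, b}|\{x: f(x+a)-f(x)=b\}|$. $f$ is zero-difference $d$-balanced if for every nonzero $a\in\mathbb{F}_q$ the equation $f(x+a)-f(x)=0$ has exactly $d$ solutions $x\in\mathbb{F}_q$. For nonzero $a$, the differential set is $D_a(f)=\{f(x+a)-f(x): x\in\mathbb{F}_q\}$. -}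

module Defs where

open import Data.Nat using (ℕ; zero; suc; _^_; _≤_; _∸_)
open import Data.Fin using (Fin; zero; suc) renaming (_≟_ to _≟ᶠ_)
open import Data.List using (List; length; filter; allFin)
open import Data.Product using (Σ; ∃; _×_; _,_)
open import Relation.Binary.PropositionalEquality using (_≡_; _≢_)
open import Relation.Nullary using (¬_)
open import Algebra.Core using (Op₁; Op₂)
import Algebra.Structures as AS

-- A finite field of order q = p ^ n, realised (up to isomorphism) on the
-- carrier Fin (p ^ n) with propositional equality.
record FiniteField (p n : ℕ) : Set where
  field
    _+_ : Op₂ (Fin (p ^ n))
    _*_ : Op₂ (Fin (p ^ n))
    -_  : Op₁ (Fin (p ^ n))
    0#  : Fin (p ^ n)
    1#  : Fin (p ^ n)
    isCommutativeRing : AS.IsCommutativeRing _≡_ _+_ _*_ -_ 0# 1#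
    0≢1 : 0# ≢ 1#
    inverse : ∀ x → x ≢ 0# → ∃ λ y → x * y ≡ 1#

  infixl 6 _+_ _-_
  infixl 7 _*_
  infix  8 _^ᶠ_

  _-_ : Op₂ (Fin (p ^ n))
  x - y = x + (- y)

  _^ᶠ_ : Fin (p ^ n) → ℕ → Fin (p ^ n)
  x ^ᶠ zero  = 1#
  x ^ᶠ suc k = x * (x ^ᶠ k)

  -- m · 1 (elements of the prime subfield F_p)
  _·1 : ℕ → Fin (p ^ n)
  zero  ·1 = 0#
  suc m ·1 = 1# + (m ·1)

  ∑ : ∀ {k} → (Fin k → Fin (p ^ n)) → Fin (p ^ n)
  ∑ {zero}  g = 0#
  ∑ {suc k} g = g zero + ∑ (λ i → g (suc i))

  count : (Fin (p ^ n) → Fin (p ^ n)) → Fin (p ^ n) → ℕ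
  count g y = length (filter (λ x → g x ≟ᶠ y) (allFin (p ^ n)))

  IsDO : (Fin (p ^ n) → Fin (p ^ n)) → Set
  IsDO f = Σ (Fin n → Fin n → Fin (p ^ n)) λ a →
             (p ≡ 2 → ∀ i → a i i ≡ 0#) ×
             (∀ x → f x ≡ ∑ (λ i → ∑ (λ j →
                a i j * (x ^ᶠ ((p ^ Data.Fin.toℕ i) Data.Nat.+ (p ^ Data.Fin.toℕ j))))))

  IsDivisible : ℕ → (Fin (p ^ n) → Fin (p ^ n)) → Set
  IsDivisible k f = Σ (Fin (p ^ n) → Fin (p ^ n)) λ f' → ∀ x → f x ≡ f' (x ^ᶠ k)

  IsAlmostKTo1 : ℕ → (Fin (p ^ n) → Fin (p ^ n)) → Set
  IsAlmostKTo1 k f = Σ (Fin (p ^ n)) λ y₀ →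
      count f y₀ ≡ 1 ×
      (∀ y → count f y ≡ 1 → y ≡ y₀) ×
      (∀ y → y ≢ y₀ → 1 ≤ count f y → count f y ≡ k)

  δ : (Fin (p ^ n) → Fin (p ^ n)) → Fin (p ^ n) → Fin (p ^ n) → ℕ
  δ f a b = count (λ x → f (x + a) - f x) b

  IsDiffUniform : ℕ → (Fin (p ^ n) → Fin (p ^ n)) → Set
  IsDiffUniform d f =
    (∀ a b → a ≢ 0# → δ f a b ≤ d) ×
    (Σ (Fin (p ^ n)) λ a → Σ (Fin (p ^ n)) λ b → a ≢ 0# × δ f a b ≡ d)

  IsZDB : ℕ → (Fin (p ^ n) → Fin (p ^ n)) → Set
  IsZDB d f = ∀ a → a ≢ 0# → δ f a 0# ≡ d

  D : (Fin (p ^ n) → Fin (p ^ n)) → Fin (p ^ n) → Fin (p ^ n) → Set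
  D f a y = ∃ λ x → f (x + a) - f x ≡ y

  IsFpSubspace : (Fin (p ^ n) → Set) → Set
  IsFpSubspace S =
    S 0# ×
    (∀ y z → S y → S z → S (y + z)) ×
    (∀ (m : ℕ) y → S y → S ((m ·1) * y))

-- Write K = d + 1. As K divides q - 1, on nonzero elements every fibre of x ↦ x ^ K has
-- μ = #{u | u ^ K = 1} ≥ K points (Fermat and the root bound for u ^ T - 1, where q - 1 = K T).
-- Since f factors through x ↦ x ^ K, the fibre of f through x ≠ 0 has at least K ≥ 2 points, so it
-- is a K-point fibre; this forces μ = K and f z = f x ⇔ z ^ K = x ^ K. Hence f (x + c) = f x iff
-- u ^ K = 1 for u = 1 + c / x ≠ 1, and x ↦ 1 + c / x is a bijection of the field (with 0 ↦ 1), so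
-- there are exactly μ - 1 = d such x, which is (a). As f is Dembowski-Ostrom, Frobenius gives
-- f (x + c) - f x = f c + B (x, c) with B additive in x, so each nonempty fibre of this difference
-- map is a coset of the kernel of B (·, c), of size d by (a); this is (b). The cosets partition the
-- field, so d divides q = p ^ n and is therefore a power of p, which is (c).

module Submission where

open import Defs
open import Data.Nat using (ℕ; suc; _^_; _∸_)
open import Data.Nat.Divisibility using (_∣_)
open import Data.Nat.Primality using (Prime)
open import Data.Fin using (Fin)
open import Data.Product using (∃; _×_)
open import Data.Product using (_,_)
open import Relation.Binary.PropositionalEquality using (_≡_; _≢_)

module PrimePowers where

  open import Data.Empty using (⊥-elim)
  open import Data.Nat.Base
  open import Data.Nat.Properties
  open import Data.Nat.Divisibility
  open import Data.Nat.DivMod using (m/n*n≡m)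
  open import Data.Nat.Primality using (Prime; euclidsLemma; ¬prime[1]; prime⇒irreducible; prime⇒nonZero)
  open import Data.Nat.Coprimality using (Coprime; coprime-divisor)
  open import Data.Nat.Combinatorics using (_C_; k![n∸k]!∣n!)
  open import Data.Nat.Combinatorics.Specification using (nCk≡n!/k![n-k]!)
  open import Data.Product.Base using (∃; _,_)
  open import Data.Sum.Base using (inj₁; inj₂)
  open import Relation.Nullary.Decidable using (yes; no)
  open import Relation.Binary.PropositionalEquality

  private variable
    p k m : ℕ

  prime⇒≡suc : Prime p → ∃ λ r → p ≡ suc r
  prime⇒≡suc {suc r} _ = r , refl

  nCk*[k!*[n∸k]!]≡n! : ∀ {n k} → k ≤ n → (n C k) * (k ! * (n ∸ k) !) ≡ n !
  nCk*[k!*[n∸k]!]≡n! {n} {k} k≤n = begin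
    (n C k) * (k ! * (n ∸ k) !)
      ≡⟨ cong (_* (k ! * (n ∸ k) !)) (nCk≡n!/k![n-k]! k≤n) ⟩
    (n ! / (k ! * (n ∸ k) !)) * (k ! * (n ∸ k) !)
      ≡⟨ m/n*n≡m (k![n∸k]!∣n! k≤n) ⟩
    n ! ∎
    where
    open ≡-Reasoning
    instance _ = k !* (n ∸ k) !≢0

  p∤k! : Prime p → k < p → p ∤ k !
  p∤k! {k = zero}  p-prime _   p∣1 = ¬prime[1] (subst Prime (∣1⇒≡1 p∣1) p-prime)
  p∤k! {k = suc k} p-prime k<p p∣k! with euclidsLemma (suc k) (k !) p-prime p∣k!
  ... | inj₁ p∣1+k = <⇒≱ k<p (∣⇒≤ p∣1+k)
  ... | inj₂ p∣k!′ = p∤k! p-prime (<-trans (n<1+n k) k<p) p∣k!′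

  p∣pCk : Prime p → 0 < k → k < p → p ∣ (p C k)
  p∣pCk {p} {k} p-prime 0<k k<p
    with euclidsLemma (p C k) (k ! * (p ∸ k) !) p-prime p∣pCk*[k!*[p∸k]!]
    where
    p∣p! : p ∣ p !
    p∣p! with prime⇒≡suc p-prime
    ... | r , refl = m∣m*n (r !)
    p∣pCk*[k!*[p∸k]!] : p ∣ (p C k) * (k ! * (p ∸ k) !)
    p∣pCk*[k!*[p∸k]!] = subst (p ∣_) (sym (nCk*[k!*[n∸k]!]≡n! (<⇒≤ k<p))) p∣p!
  ... | inj₁ p∣C = p∣C
  ... | inj₂ p∣k!*[p∸k]! with euclidsLemma (k !) ((p ∸ k) !) p-prime p∣k!*[p∸k]!
  ...   | inj₁ p∣k!     = ⊥-elim (p∤k! p-prime k<p p∣k!)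
  ...   | inj₂ p∣[p∸k]! = ⊥-elim (p∤k! p-prime (∸-monoʳ-< 0<k (<⇒≤ k<p)) p∣[p∸k]!)

  ∣p^n⇒≡p^i : Prime p → ∀ n → m ∣ p ^ n → ∃ λ i → m ≡ p ^ i
  ∣p^n⇒≡p^i p-prime zero m∣1 = 0 , ∣1⇒≡1 m∣1
  ∣p^n⇒≡p^i {p} {m} p-prime (suc n) m∣p^[1+n] with p ∣? m
  ... | yes (divides m′ refl) with ∣p^n⇒≡p^i p-prime n m′∣p^n
    where
    instance _ = prime⇒nonZero p-prime
    m′∣p^n : m′ ∣ p ^ n
    m′∣p^n = *-cancelʳ-∣ p (subst (m′ * p ∣_) (*-comm p (p ^ n)) m∣p^[1+n])
  ...   | i , refl = suc i , *-comm (p ^ i) p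
  ∣p^n⇒≡p^i {p} {m} p-prime (suc n) m∣p^[1+n] | no p∤m =
    ∣p^n⇒≡p^i p-prime n (coprime-divisor m⊥p m∣p^[1+n])
    where
    m⊥p : Coprime m p
    m⊥p (i∣m , i∣p) with prime⇒irreducible p-prime i∣p
    ... | inj₁ i≡1 = i≡1
    ... | inj₂ refl = ⊥-elim (p∤m i∣m)

module Counting where

  open import Data.Bool.Base using (Bool; true; false; _∧_; _∨_; not)
  open import Data.Bool.Properties using (∧-zeroʳ)
  open import Data.Empty using (⊥-elim)
  open import Data.Fin.Base using (Fin; zero; suc)
  open import Data.Fin.Properties using (_≟_)
  open import Data.Fin.Permutation using (permutation)
  open import Data.List.Base using (length; filter; tabulate; allFin)
  open import Data.Nat.Base using (ℕ; zero; suc; _+_; _*_; _≤_; z≤n; s≤s)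
  open import Data.Nat.Properties hiding (_≟_)
  open import Data.Nat.Divisibility using (_∣_; ∣m∣n⇒∣m+n; _∣0)
  open import Data.Product.Base using (∃; _,_)
  open import Data.Sum.Base using (_⊎_; inj₁; inj₂)
  open import Function.Base using (_∘_)
  open import Relation.Nullary.Decidable using (Dec; yes; no; does)
  open import Relation.Binary.PropositionalEquality
  import Algebra.Properties.CommutativeMonoid.Sum as CMSum
  open CMSum +-0-commutativeMonoid public using (sum)
  open CMSum +-0-commutativeMonoid using (sum-cong-≗; sum-permute; ∑-comm; ∑-distrib-+)
  open import Algebra.Properties.Semiring.Sum +-*-semiring using (*-distribˡ-sum)

  private variable
    m : ℕ

  ind : Bool → ℕ
  ind true  = 1
  ind false = 0

  infix 4 _==_ _⊆_

  _==_ : Fin m → Fin m → Bool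
  x == y = does (x ≟ y)

  card : (Fin m → Bool) → ℕ
  card B = sum (ind ∘ B)

  _⊆_ : (B C : Fin m → Bool) → Set
  B ⊆ C = ∀ x → B x ≡ true → C x ≡ true

  ≡⇒== : {x y : Fin m} → x ≡ y → (x == y) ≡ true
  ≡⇒== {x = x} refl with x ≟ x
  ... | yes _  = refl
  ... | no x≢x = ⊥-elim (x≢x refl)

  ==⇒≡ : {x y : Fin m} → (x == y) ≡ true → x ≡ y
  ==⇒≡ {x = x} {y} e with x ≟ y
  ... | yes x≡y = x≡y

  ≢⇒==-false : {x y : Fin m} → x ≢ y → (x == y) ≡ false
  ≢⇒==-false {x = x} {y} x≢y with x ≟ y
  ... | yes x≡y = ⊥-elim (x≢y x≡y)
  ... | no _    = refl

  ==-sym : (x y : Fin m) → (x == y) ≡ (y == x)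
  ==-sym x y with x ≟ y | y ≟ x
  ... | yes _   | yes _   = refl
  ... | no _    | no _    = refl
  ... | yes x≡y | no y≢x  = ⊥-elim (y≢x (sym x≡y))
  ... | no x≢y  | yes y≡x = ⊥-elim (x≢y (sym y≡x))

  ==-⇔ : ∀ {k} {a b : Fin m} {c d : Fin k} →
         (a ≡ b → c ≡ d) → (c ≡ d → a ≡ b) → (a == b) ≡ (c == d)
  ==-⇔ {a = a} {b} {c} {d} to from with a ≟ b | c ≟ d
  ... | yes _   | yes _   = refl
  ... | no _    | no _    = refl
  ... | yes a≡b | no c≢d  = ⊥-elim (c≢d (to a≡b))
  ... | no a≢b  | yes c≡d = ⊥-elim (a≢b (from c≡d))

  length-filter≡card : ∀ {A : Set} (_≟ᴬ_ : (a b : A) → Dec (a ≡ b)) (g : Fin m → A) (y : A) →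
               length (filter (λ x → g x ≟ᴬ y) (allFin m)) ≡ card (λ x → does (g x ≟ᴬ y))
  length-filter≡card {m} _≟ᴬ_ g y = go (λ i → i)
    where
    go : ∀ {k} (h : Fin k → Fin m) →
         length (filter (λ x → g x ≟ᴬ y) (tabulate h)) ≡ card (λ i → does (g (h i) ≟ᴬ y))
    go {zero}  h = refl
    go {suc k} h with g (h zero) ≟ᴬ y
    ... | yes _ = cong suc (go (h ∘ suc))
    ... | no _  = go (h ∘ suc)

  card-cong : {B C : Fin m → Bool} → (∀ x → B x ≡ C x) → card B ≡ card C
  card-cong B≗C = sum-cong-≗ (cong ind ∘ B≗C)

  sum-mono : {g h : Fin m → ℕ} → (∀ i → g i ≤ h i) → sum g ≤ sum h
  sum-mono {zero}  g≤h = z≤n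
  sum-mono {suc m} g≤h = +-mono-≤ (g≤h zero) (sum-mono (g≤h ∘ suc))

  card-mono : {B C : Fin m → Bool} → B ⊆ C → card B ≤ card C
  card-mono B⊆C = sum-mono (λ x → ind-mono (B⊆C x))
    where
    ind-mono : ∀ {b c} → (b ≡ true → c ≡ true) → ind b ≤ ind c
    ind-mono {false} _   = z≤n
    ind-mono {true}  b⇒c rewrite b⇒c refl = ≤-refl

  card-∘-bijection : (B : Fin m → Bool) (f g : Fin m → Fin m) →
                     (∀ y → f (g y) ≡ y) → (∀ x → g (f x) ≡ x) → card (B ∘ f) ≡ card B
  card-∘-bijection B f g fg gf = sym (sum-permute (ind ∘ B) (permutation f g fg gf))

  card-split : (B C : Fin m → Bool) → card B ≡ card (λ x → B x ∧ C x) + card (λ x → B x ∧ not (C x))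
  card-split {m} B C = trans (sum-cong-≗ (λ x → ind-split (B x) (C x))) (∑-distrib-+ {m} _ _)
    where
    ind-split : ∀ b c → ind b ≡ ind (b ∧ c) + ind (b ∧ not c)
    ind-split false c     = refl
    ind-split true  false = refl
    ind-split true  true  = refl

  card-∨ : (B C : Fin m → Bool) → card (λ x → B x ∨ C x) ≤ card B + card C
  card-∨ {m} B C = ≤-trans (sum-mono (λ x → ind-∨ (B x) (C x))) (≤-reflexive (∑-distrib-+ {m} _ _))
    where
    ind-∨ : ∀ b c → ind (b ∨ c) ≤ ind b + ind c
    ind-∨ false c = ≤-refl
    ind-∨ true  c = s≤s z≤n

  card-const-false : card {m} (λ _ → false) ≡ 0
  card-const-false {zero}  = refl
  card-const-false {suc m} = card-const-false {m}

  card-const-true : card {m} (λ _ → true) ≡ m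
  card-const-true {zero}  = refl
  card-const-true {suc m} = cong suc (card-const-true {m})

  card-witness : (B : Fin m → Bool) → (∃ λ x → B x ≡ true) ⊎ card B ≡ 0
  card-witness {zero}  B = inj₂ refl
  card-witness {suc m} B with B zero in B0
  ... | true  = inj₁ (zero , B0)
  ... | false with card-witness (B ∘ suc)
  ...   | inj₁ (x , Bx) = inj₁ (suc x , Bx)
  ...   | inj₂ c≡0      = inj₂ c≡0

  card-pos⇒witness : (B : Fin m → Bool) → 1 ≤ card B → ∃ λ x → B x ≡ true
  card-pos⇒witness B 1≤c with card-witness B
  ... | inj₁ w   = w
  ... | inj₂ c≡0 = ⊥-elim (1+n≰n (subst (1 ≤_) c≡0 1≤c))

  card≡0⇒false : (B : Fin m → Bool) → card B ≡ 0 → ∀ x → B x ≡ false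
  card≡0⇒false B c≡0 zero    with B zero
  ... | false = refl
  card≡0⇒false B c≡0 (suc x) with B zero
  ... | false = card≡0⇒false (B ∘ suc) c≡0 x

  card-singleton : (x : Fin m) → card (x ==_) ≡ 1
  card-singleton {suc m} zero    = cong suc (card-const-false {m})
  card-singleton (suc x) = card-singleton x

  card-singleton′ : (x : Fin m) → card (_== x) ≡ 1
  card-singleton′ x = trans (card-cong (λ y → ==-sym y x)) (card-singleton x)

  ⊆∧card≡⇒⊇ : (B C : Fin m → Bool) → B ⊆ C → card B ≡ card C → C ⊆ B
  ⊆∧card≡⇒⊇ B C B⊆C cB≡cC x Cx = decide (B x) refl
    where
    C∧B≗B : ∀ z → (C z ∧ B z) ≡ B z
    C∧B≗B z with B z in Bz
    ... | false = ∧-zeroʳ (C z)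
    ... | true  rewrite B⊆C z Bz = refl
    rest≡0 : card (λ z → C z ∧ not (B z)) ≡ 0
    rest≡0 = +-cancelˡ-≡ (card B) _ 0 (begin
      card B + card (λ z → C z ∧ not (B z))             ≡⟨ cong (_+ card (λ z → C z ∧ not (B z))) (card-cong C∧B≗B) ⟨
      card (λ z → C z ∧ B z) + card (λ z → C z ∧ not (B z)) ≡⟨ card-split C B ⟨
      card C                                            ≡⟨ cB≡cC ⟨
      card B                                            ≡⟨ +-identityʳ (card B) ⟨
      card B + 0                                        ∎)
      where open ≡-Reasoning
    decide : ∀ b → B x ≡ b → B x ≡ true
    decide true  Bx = Bx
    decide false Bx
      with () ← trans (sym (card≡0⇒false _ rest≡0 x)) (cong₂ (λ c b → c ∧ not b) Cx Bx)

  card-fibres : ∀ {k} (g : Fin m → Fin k) (c : Fin k → ℕ) →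
                sum (c ∘ g) ≡ sum (λ y → c y * card (λ x → g x == y))
  card-fibres {m} g c = begin
    sum (c ∘ g)
      ≡⟨ sum-cong-≗ (λ x → sym (pick (g x) c)) ⟩
    sum (λ x → sum (λ y → ind (g x == y) * c y))
      ≡⟨ ∑-comm (λ x y → ind (g x == y) * c y) ⟩
    sum (λ y → sum (λ x → ind (g x == y) * c y))
      ≡⟨ sum-cong-≗ (λ y → sum-cong-≗ (λ x → *-comm (ind (g x == y)) (c y))) ⟩
    sum (λ y → sum (λ x → c y * ind (g x == y)))
      ≡⟨ sum-cong-≗ (λ y → *-distribˡ-sum {m} (c y) _) ⟨
    sum (λ y → c y * card (λ x → g x == y)) ∎
    where
    open ≡-Reasoning
    -- zero == suc y computes to false, so the tail of the sum is card-const-false.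
    pick : ∀ {k} (z : Fin k) (c : Fin k → ℕ) → sum (λ y → ind (z == y) * c y) ≡ c z
    pick {suc k} zero    c =
      trans (cong (c zero + 0 +_) (card-const-false {k})) (trans (+-identityʳ _) (+-identityʳ _))
    pick {suc k} (suc z) c = pick z (c ∘ suc)

  ∣-sum : ∀ {d} (g : Fin m → ℕ) → (∀ i → d ∣ g i) → d ∣ sum g
  ∣-sum {zero}      g d∣g = _ ∣0
  ∣-sum {suc m} {d} g d∣g = ∣m∣n⇒∣m+n (d∣g zero) (∣-sum (g ∘ suc) (d∣g ∘ suc))

module FieldTheory where

  open import Algebra.Bundles using (CommutativeRing; CommutativeSemiring)
  import Algebra.Properties.Ring as RingProperties
  open import Data.Empty using (⊥-elim)
  open import Data.Fin.Properties using (_≟_)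
  open import Data.Nat.Base as ℕ using (zero; _<_; s≤s; z≤n)
  open import Data.Product.Base using (proj₁; proj₂)
  open import Function.Base using (_∘_)
  open import Relation.Nullary.Decidable using (yes; no)
  open import Relation.Binary.PropositionalEquality
  open PrimePowers using (prime⇒≡suc; p∣pCk)

  module FieldArithmetic {p n : ℕ} (F : FiniteField p n) where

    open FiniteField F public

    commutativeRing : CommutativeRing _ _
    commutativeRing = record { isCommutativeRing = isCommutativeRing }

    open CommutativeRing commutativeRing public
      using ( Carrier; +-comm; +-assoc; +-identityˡ; +-identityʳ
            ; *-comm; *-assoc; *-identityˡ; *-identityʳ; distribˡ; distribʳ; zeroˡ; zeroʳ
            ; ring; commutativeSemiring; +-commutativeMonoid; *-commutativeMonoid)
    open RingProperties ring public
      using (+-cancelˡ; x[y-z]≈xy-xz)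
      renaming (x∙y⁻¹≈ε⇒x≈y to x-y≡0⇒x≡y; x≈y⇒x∙y⁻¹≈ε to x≡y⇒x-y≡0)
    open RingProperties ring using (//-rightDividesˡ; //-rightDividesʳ)
    open import Algebra.Solver.Ring.NaturalCoefficients.Default commutativeSemiring public
      using (solve; _:=_; _:+_; _:*_; con)

    open ≡-Reasoning

    x-y+y≡x : ∀ x y → x - y + y ≡ x
    x-y+y≡x x y = //-rightDividesˡ y x

    x+y-y≡x : ∀ x y → x + y - y ≡ x
    x+y-y≡x x y = //-rightDividesʳ y x

    1≢0 : 1# ≢ 0#
    1≢0 1≡0 = 0≢1 (sym 1≡0)

    x*y≡0⇒y≡0 : ∀ {x y} → x ≢ 0# → x * y ≡ 0# → y ≡ 0#
    x*y≡0⇒y≡0 {x} {y} x≢0 xy≡0 = begin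
      y                      ≡⟨ *-identityˡ y ⟨
      1# * y                 ≡⟨ cong (_* y) (trans (*-comm x′ x) x′x) ⟨
      (x′ * x) * y           ≡⟨ *-assoc x′ x y ⟩
      x′ * (x * y)           ≡⟨ cong (x′ *_) xy≡0 ⟩
      x′ * 0#                ≡⟨ zeroʳ x′ ⟩
      0#                     ∎
      where
      x′  = proj₁ (inverse x x≢0)
      x′x = proj₂ (inverse x x≢0)

    *-≢0 : ∀ {x y} → x ≢ 0# → y ≢ 0# → x * y ≢ 0#
    *-≢0 x≢0 y≢0 xy≡0 = y≢0 (x*y≡0⇒y≡0 x≢0 xy≡0)

    *-cancelˡ-≢0 : ∀ {x y z} → x ≢ 0# → x * y ≡ x * z → y ≡ z
    *-cancelˡ-≢0 {x} {y} {z} x≢0 xy≡xz =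
      x-y≡0⇒x≡y y z (x*y≡0⇒y≡0 x≢0 (trans (x[y-z]≈xy-xz x y z) (x≡y⇒x-y≡0 xy≡xz)))

    infix 9 _⁻¹

    _⁻¹ : Carrier → Carrier
    x ⁻¹ with x ≟ 0#
    ... | yes _   = 0#
    ... | no  x≢0 = proj₁ (inverse x x≢0)

    x*x⁻¹≡1 : ∀ {x} → x ≢ 0# → x * x ⁻¹ ≡ 1#
    x*x⁻¹≡1 {x} x≢0 with x ≟ 0#
    ... | yes x≡0  = ⊥-elim (x≢0 x≡0)
    ... | no  x≢0′ = proj₂ (inverse x x≢0′)

    x⁻¹*x≡1 : ∀ {x} → x ≢ 0# → x ⁻¹ * x ≡ 1#
    x⁻¹*x≡1 {x} x≢0 = trans (*-comm (x ⁻¹) x) (x*x⁻¹≡1 x≢0)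

    0⁻¹≡0 : 0# ⁻¹ ≡ 0#
    0⁻¹≡0 with 0# ≟ 0#
    ... | yes _   = refl
    ... | no  0≢0 = ⊥-elim (0≢0 refl)

    ⁻¹-≢0 : ∀ {x} → x ≢ 0# → x ⁻¹ ≢ 0#
    ⁻¹-≢0 {x} x≢0 x⁻¹≡0 = 1≢0 (begin
      1#         ≡⟨ x*x⁻¹≡1 x≢0 ⟨
      x * x ⁻¹   ≡⟨ cong (x *_) x⁻¹≡0 ⟩
      x * 0#     ≡⟨ zeroʳ x ⟩
      0#         ∎)

    x*y≡1⇒x⁻¹≡y : ∀ {x y} → x * y ≡ 1# → x ⁻¹ ≡ y
    x*y≡1⇒x⁻¹≡y {x} {y} xy≡1 = *-cancelˡ-≢0 x≢0 (trans (x*x⁻¹≡1 x≢0) (sym xy≡1))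
      where
      x≢0 : x ≢ 0#
      x≢0 x≡0 = 0≢1 (trans (sym (zeroˡ y)) (trans (cong (_* y) (sym x≡0)) xy≡1))

    ⁻¹-involutive : ∀ x → x ⁻¹ ⁻¹ ≡ x
    ⁻¹-involutive x with x ≟ 0#
    ... | yes x≡0 = trans 0⁻¹≡0 (sym x≡0)
    ... | no  x≢0  = x*y≡1⇒x⁻¹≡y (trans (*-comm _ x) (proj₂ (inverse x x≢0)))

    ⁻¹*[x*y]≡y : ∀ {x} y → x ≢ 0# → x ⁻¹ * (x * y) ≡ y
    ⁻¹*[x*y]≡y {x} y x≢0 = begin
      x ⁻¹ * (x * y)  ≡⟨ *-assoc (x ⁻¹) x y ⟨
      x ⁻¹ * x * y    ≡⟨ cong (_* y) (x⁻¹*x≡1 x≢0) ⟩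
      1# * y          ≡⟨ *-identityˡ y ⟩
      y               ∎

    x*[x⁻¹*y]≡y : ∀ {x} y → x ≢ 0# → x * (x ⁻¹ * y) ≡ y
    x*[x⁻¹*y]≡y {x} y x≢0 = begin
      x * (x ⁻¹ * y)  ≡⟨ *-assoc x (x ⁻¹) y ⟨
      x * x ⁻¹ * y    ≡⟨ cong (_* y) (x*x⁻¹≡1 x≢0) ⟩
      1# * y          ≡⟨ *-identityˡ y ⟩
      y               ∎

    ^ᶠ-+ : ∀ x a b → x ^ᶠ (a ℕ.+ b) ≡ x ^ᶠ a * x ^ᶠ b
    ^ᶠ-+ x zero    b = sym (*-identityˡ _)
    ^ᶠ-+ x (suc a) b = trans (cong (x *_) (^ᶠ-+ x a b)) (sym (*-assoc x _ _))

    ^ᶠ-* : ∀ x a b → x ^ᶠ (a ℕ.* b) ≡ (x ^ᶠ b) ^ᶠ a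
    ^ᶠ-* x zero    b = refl
    ^ᶠ-* x (suc a) b = trans (^ᶠ-+ x b (a ℕ.* b)) (cong (x ^ᶠ b *_) (^ᶠ-* x a b))

    *-^ᶠ : ∀ x y k → (x * y) ^ᶠ k ≡ x ^ᶠ k * y ^ᶠ k
    *-^ᶠ x y zero    = sym (*-identityˡ 1#)
    *-^ᶠ x y (suc k) = trans (cong ((x * y) *_) (*-^ᶠ x y k))
      (solve 4 (λ x y a b → (x :* y) :* (a :* b) := (x :* a) :* (y :* b)) refl x y (x ^ᶠ k) (y ^ᶠ k))

    x^ᶠ1≡x : ∀ x → x ^ᶠ 1 ≡ x
    x^ᶠ1≡x = *-identityʳ

    0^ᶠsuc≡0 : ∀ k → 0# ^ᶠ suc k ≡ 0#
    0^ᶠsuc≡0 k = zeroˡ _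

    1^ᶠ≡1 : ∀ k → 1# ^ᶠ k ≡ 1#
    1^ᶠ≡1 zero    = refl
    1^ᶠ≡1 (suc k) = trans (*-identityˡ _) (1^ᶠ≡1 k)

    ^ᶠ-≢0 : ∀ {x} k → x ≢ 0# → x ^ᶠ k ≢ 0#
    ^ᶠ-≢0 zero    x≢0 = 1≢0
    ^ᶠ-≢0 (suc k) x≢0 = *-≢0 x≢0 (^ᶠ-≢0 k x≢0)

    x^ᶠk≡0⇒x≡0 : ∀ {x} k → x ^ᶠ k ≡ 0# → x ≡ 0#
    x^ᶠk≡0⇒x≡0 {x} k x^k≡0 with x ≟ 0#
    ... | yes x≡0 = x≡0
    ... | no  x≢0 = ⊥-elim (^ᶠ-≢0 k x≢0 x^k≡0)

    ·1-+ : ∀ a b → (a ℕ.+ b) ·1 ≡ a ·1 + b ·1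
    ·1-+ zero    b = sym (+-identityˡ _)
    ·1-+ (suc a) b = trans (cong (1# +_) (·1-+ a b)) (sym (+-assoc 1# _ _))

    ·1-suc-* : ∀ m y → (suc m ·1) * y ≡ y + (m ·1) * y
    ·1-suc-* m y = trans (distribʳ y 1# (m ·1)) (cong (_+ (m ·1) * y) (*-identityˡ y))

    ·1-* : ∀ a b → (a ℕ.* b) ·1 ≡ a ·1 * b ·1
    ·1-* zero    b = sym (zeroˡ _)
    ·1-* (suc a) b = trans (·1-+ b (a ℕ.* b)) (trans (cong (b ·1 +_) (·1-* a b)) (sym (·1-suc-* a (b ·1))))

    ·1-^ : ∀ a k → (a ℕ.^ k) ·1 ≡ (a ·1) ^ᶠ k
    ·1-^ a zero    = +-identityʳ 1#
    ·1-^ a (suc k) = trans (·1-* a (a ℕ.^ k)) (cong (a ·1 *_) (·1-^ a k))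

  module Characteristic {p n : ℕ} (F : FiniteField p n) where

    open FieldArithmetic F
    open import Algebra.Properties.CommutativeMonoid.Sum +-commutativeMonoid
      using (sum; sum-permute; ∑-distrib-+)
    open import Data.Fin.Permutation using (permutation)
    open import Data.Nat.Divisibility using (_∣_; divides)
    open ≡-Reasoning

    sum-const : ∀ {m} x → sum {m} (λ _ → x) ≡ (m ·1) * x
    sum-const {zero}  x = sym (zeroˡ x)
    sum-const {suc m} x = trans (cong (x +_) (sum-const {m} x)) (sym (·1-suc-* m x))

    -- Translation by x permutes the field, so Σ y = Σ (y + x) = Σ y + q · x.
    q·1*x≡0 : ∀ x → ((p ℕ.^ n) ·1) * x ≡ 0#
    q·1*x≡0 x = +-cancelˡ (sum id) _ _ (begin
      sum id + (q ·1) * x          ≡⟨ cong (sum id +_) (sum-const {q} x) ⟨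
      sum id + sum {q} (λ _ → x)   ≡⟨ ∑-distrib-+ {q} id (λ _ → x) ⟨
      sum (λ y → y + x)            ≡⟨ sum-permute id translation ⟨
      sum id                       ≡⟨ +-identityʳ (sum id) ⟨
      sum id + 0#                  ∎)
      where
      q = p ℕ.^ n
      id : Carrier → Carrier
      id y = y
      translation = permutation (_+ x) (_- x) (λ y → x-y+y≡x y x) (λ y → x+y-y≡x y x)

    p·1≡0 : p ·1 ≡ 0#
    p·1≡0 = x^ᶠk≡0⇒x≡0 n (begin
      (p ·1) ^ᶠ n           ≡⟨ ·1-^ p n ⟨
      (p ℕ.^ n) ·1          ≡⟨ *-identityʳ _ ⟨
      (p ℕ.^ n) ·1 * 1#     ≡⟨ q·1*x≡0 1# ⟩
      0#                    ∎)

    p∣m⇒m·1≡0 : ∀ {m} → p ∣ m → m ·1 ≡ 0#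
    p∣m⇒m·1≡0 (divides k refl) = trans (·1-* k p) (trans (cong (k ·1 *_) p·1≡0) (zeroʳ _))

  module Frobenius {p n : ℕ} (F : FiniteField p n) (p-prime : Prime p) where

    open FieldArithmetic F
    open Characteristic F using (p∣m⇒m·1≡0)
    open import Algebra.Definitions.RawSemiring (CommutativeSemiring.rawSemiring commutativeSemiring)
      using () renaming (_×_ to _×ʳ_; _^_ to _^ʳ_)
    open import Algebra.Properties.CommutativeSemiring.Binomial commutativeSemiring
      using (theorem; binomialExpansion; binomialTerm)
    open import Algebra.Properties.CommutativeMonoid.Sum +-commutativeMonoid using (sum)
    open import Data.Fin.Base using (zero; suc; toℕ; inject₁; fromℕ)
    open import Data.Fin.Properties using (toℕ-inject₁; toℕ-fromℕ; toℕ<n)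
    open import Data.Nat.Combinatorics using (_C_; nCn≡1)
    open import Data.Nat.Properties using (n∸n≡0)
    open ≡-Reasoning

    ^ʳ≡^ᶠ : ∀ x k → x ^ʳ k ≡ x ^ᶠ k
    ^ʳ≡^ᶠ x zero    = refl
    ^ʳ≡^ᶠ x (suc k) = cong (x *_) (^ʳ≡^ᶠ x k)

    ×ʳ≡·1* : ∀ m x → m ×ʳ x ≡ (m ·1) * x
    ×ʳ≡·1* zero    x = sym (zeroˡ x)
    ×ʳ≡·1* (suc m) x = trans (cong (x +_) (×ʳ≡·1* m x)) (sym (·1-suc-* m x))

    private
      sum-last : ∀ {m} (g : Fin (suc m) → Carrier) → (∀ i → g (inject₁ i) ≡ 0#) → sum g ≡ g (fromℕ m)
      sum-last {zero}  g _   = +-identityʳ _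
      sum-last {suc m} g g≡0 = trans (cong (_+ sum (λ i → g (suc i))) (g≡0 zero))
        (trans (+-identityˡ _) (sum-last (λ i → g (suc i)) (λ i → g≡0 (suc i))))

    frobenius : ∀ x y → (x + y) ^ᶠ p ≡ x ^ᶠ p + y ^ᶠ p
    frobenius x y with prime⇒≡suc p-prime
    ... | m , refl = begin
      (x + y) ^ᶠ p                          ≡⟨ ^ʳ≡^ᶠ (x + y) p ⟨
      (x + y) ^ʳ p                           ≡⟨ theorem p x y ⟩
      binomialExpansion x y p               ≡⟨ cong (T zero +_) (sum-last (T ∘ suc) middle-vanishes) ⟩
      T zero + T (suc (fromℕ m))            ≡⟨ cong₂ _+_ first last ⟩
      y ^ᶠ p + x ^ᶠ p                       ≡⟨ +-comm _ _ ⟩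
      x ^ᶠ p + y ^ᶠ p                       ∎
      where
      T = binomialTerm x y p
      middle-vanishes : ∀ i → T (suc (inject₁ i)) ≡ 0#
      middle-vanishes i = begin
        T (suc (inject₁ i))     ≡⟨ ×ʳ≡·1* c _ ⟩
        (c ·1) * B               ≡⟨ cong (_* B) (p∣m⇒m·1≡0 (p∣pCk p-prime (s≤s z≤n) k<p)) ⟩
        0# * B                   ≡⟨ zeroˡ B ⟩
        0#                       ∎
        where
        c = p C suc (toℕ (inject₁ i))
        B = x ^ʳ suc (toℕ (inject₁ i)) * y ^ʳ (p ∸ suc (toℕ (inject₁ i)))
        k<p : suc (toℕ (inject₁ i)) < p
        k<p = s≤s (subst (_< m) (sym (toℕ-inject₁ i)) (toℕ<n i))
      first : T zero ≡ y ^ᶠ p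
      first = begin
        1 ×ʳ (1# * y ^ʳ p)                    ≡⟨ ×ʳ≡·1* 1 _ ⟩
        (1# + 0#) * (1# * y ^ʳ p)            ≡⟨ cong₂ _*_ (+-identityʳ 1#) (*-identityˡ _) ⟩
        1# * y ^ʳ p                          ≡⟨ *-identityˡ _ ⟩
        y ^ʳ p                               ≡⟨ ^ʳ≡^ᶠ y p ⟩
        y ^ᶠ p                              ∎
      last : T (suc (fromℕ m)) ≡ x ^ᶠ p
      last = begin
        T (suc (fromℕ m))
          ≡⟨ cong (λ k → (p C k) ×ʳ (x ^ʳ k * y ^ʳ (p ∸ k))) (cong suc (toℕ-fromℕ m)) ⟩
        (p C p) ×ʳ (x ^ʳ p * y ^ʳ (p ∸ p))
          ≡⟨ cong₂ (λ c k → c ×ʳ (x ^ʳ p * y ^ʳ k)) (nCn≡1 p) (n∸n≡0 p) ⟩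
        1 ×ʳ (x ^ʳ p * 1#)
          ≡⟨ ×ʳ≡·1* 1 _ ⟩
        (1# + 0#) * (x ^ʳ p * 1#)
          ≡⟨ cong₂ _*_ (+-identityʳ 1#) (*-identityʳ _) ⟩
        1# * x ^ʳ p
          ≡⟨ *-identityˡ _ ⟩
        x ^ʳ p
          ≡⟨ ^ʳ≡^ᶠ x p ⟩
        x ^ᶠ p ∎

    frobenius-^ : ∀ i x y → (x + y) ^ᶠ (p ℕ.^ i) ≡ x ^ᶠ (p ℕ.^ i) + y ^ᶠ (p ℕ.^ i)
    frobenius-^ zero    x y = trans (x^ᶠ1≡x _) (sym (cong₂ _+_ (x^ᶠ1≡x x) (x^ᶠ1≡x y)))
    frobenius-^ (suc i) x y = begin
      (x + y) ^ᶠ (p ℕ.* p ℕ.^ i)                   ≡⟨ ^ᶠ-* (x + y) p (p ℕ.^ i) ⟩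
      ((x + y) ^ᶠ (p ℕ.^ i)) ^ᶠ p                  ≡⟨ cong (_^ᶠ p) (frobenius-^ i x y) ⟩
      (x ^ᶠ (p ℕ.^ i) + y ^ᶠ (p ℕ.^ i)) ^ᶠ p        ≡⟨ frobenius _ _ ⟩
      (x ^ᶠ (p ℕ.^ i)) ^ᶠ p + (y ^ᶠ (p ℕ.^ i)) ^ᶠ p ≡⟨ cong₂ _+_ (^ᶠ-* x p (p ℕ.^ i)) (^ᶠ-* y p (p ℕ.^ i)) ⟨
      x ^ᶠ (p ℕ.* p ℕ.^ i) + y ^ᶠ (p ℕ.* p ℕ.^ i)   ∎

module RootCounting {p n : ℕ} (F : FiniteField p n) where

  open import Data.Bool.Base using (Bool; true; false; _∧_; _∨_; not; if_then_else_)
  open import Data.Bool.Properties using (∧-zeroʳ; ∧-identityʳ)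
  open import Data.Empty using (⊥-elim)
  open import Data.Fin.Base using (zero)
  open import Data.Fin.Permutation using (permutation)
  open import Data.Fin.Properties using (_≟_)
  open import Data.Nat.Base as ℕ using (zero)
  import Data.Nat.Properties as ℕₚ
  open import Data.Sum.Base using (inj₁; inj₂)
  open import Function.Base using (_∘_)
  open import Relation.Nullary.Decidable using (Dec; yes; no)
  open import Relation.Binary.PropositionalEquality
  open import Algebra.Properties.CommutativeMonoid.Sum ℕₚ.+-0-commutativeMonoid using (sum-cong-≗)
  open import Algebra.Properties.Semiring.Sum ℕₚ.+-*-semiring using (*-distribˡ-sum)
  open Counting
  open FieldTheory.FieldArithmetic F
  open import Algebra.Properties.CommutativeMonoid.Sum *-commutativeMonoid
    using () renaming ( sum to product; sum-cong-≗ to product-cong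
                      ; sum-permute to product-permute; ∑-distrib-+ to ∏-distrib-*)

  q : ℕ
  q = p ℕ.^ n

  2≤q : 2 ℕ.≤ q
  2≤q = two-elements 0# 1# 0≢1
    where
    two-elements : ∀ {m} (a b : Fin m) → a ≢ b → 2 ℕ.≤ m
    two-elements {suc zero}    zero zero a≢b = ⊥-elim (a≢b refl)
    two-elements {suc (suc m)} _    _    _   = ℕ.s≤s (ℕ.s≤s ℕ.z≤n)

  nonzero : Carrier → Bool
  nonzero y = not (y == 0#)

  card-nonzero : card nonzero ≡ q ℕ.∸ 1
  card-nonzero = begin
    card nonzero                          ≡⟨ ℕₚ.m+n∸m≡n 1 (card nonzero) ⟨
    suc (card nonzero) ℕ.∸ 1              ≡⟨ cong (ℕ._∸ 1) 1+card≡q ⟩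
    q ℕ.∸ 1                               ∎
    where
    open ≡-Reasoning
    1+card≡q : suc (card nonzero) ≡ q
    1+card≡q = begin
      suc (card nonzero)                  ≡⟨ cong (ℕ._+ card nonzero) (card-singleton′ 0#) ⟨
      card (_== 0#) ℕ.+ card nonzero      ≡⟨ card-split (λ _ → true) (_== 0#) ⟨
      card {q} (λ _ → true)               ≡⟨ card-const-true ⟩
      q                                   ∎

  private
    nonzero-part : Carrier → Carrier
    nonzero-part y = if y == 0# then 1# else y

    product-≢0 : ∀ {m} (g : Fin m → Carrier) → (∀ i → g i ≢ 0#) → product g ≢ 0#
    product-≢0 {zero}  g g≢0 = 1≢0
    product-≢0 {suc m} g g≢0 = *-≢0 (g≢0 _) (product-≢0 (g ∘ Fin.suc) (g≢0 ∘ Fin.suc))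

    product-if : ∀ {m} (B : Fin m → Bool) x → product (λ y → if B y then x else 1#) ≡ x ^ᶠ card B
    product-if {zero}  B x = refl
    product-if {suc m} B x with B Fin.zero
    ... | true  = cong (x *_) (product-if (B ∘ Fin.suc) x)
    ... | false = trans (*-identityˡ _) (product-if (B ∘ Fin.suc) x)

  -- Multiplication by x permutes the field, so ∏ y≠0 y = ∏ y≠0 (x y) = x^(q-1) ∏ y≠0 y.
  fermat : ∀ {x} → x ≢ 0# → x ^ᶠ (q ℕ.∸ 1) ≡ 1#
  fermat {x} x≢0 = *-cancelˡ-≢0 (product-≢0 nonzero-part nonzero-part-≢0) (begin
    P * x ^ᶠ (q ℕ.∸ 1)                                          ≡⟨ *-comm P _ ⟩
    x ^ᶠ (q ℕ.∸ 1) * P                                          ≡⟨ cong (_* P) x^[q-1]≡∏ ⟩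
    product (λ y → if nonzero y then x else 1#) * P             ≡⟨ ∏-distrib-* {q} _ nonzero-part ⟨
    product (λ y → (if nonzero y then x else 1#) * nonzero-part y) ≡⟨ product-cong scale ⟨
    product (nonzero-part ∘ (x *_))                             ≡⟨ product-permute nonzero-part x*-permutation ⟨
    P                                                           ≡⟨ *-identityʳ P ⟨
    P * 1#                                                      ∎)
    where
    open ≡-Reasoning
    P = product nonzero-part
    x^[q-1]≡∏ : x ^ᶠ (q ℕ.∸ 1) ≡ product (λ y → if nonzero y then x else 1#)
    x^[q-1]≡∏ = sym (trans (product-if nonzero x) (cong (x ^ᶠ_) card-nonzero))
    x*-permutation = permutation (x *_) (x ⁻¹ *_) (λ y → x*[x⁻¹*y]≡y y x≢0) (λ y → ⁻¹*[x*y]≡y y x≢0)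
    nonzero-part-≢0 : ∀ y → nonzero-part y ≢ 0#
    nonzero-part-≢0 y with y ≟ 0#
    ... | yes _   = 1≢0
    ... | no  y≢0 = y≢0
    scale : ∀ y → nonzero-part (x * y) ≡ (if nonzero y then x else 1#) * nonzero-part y
    scale y with y ≟ 0#
    ... | yes refl = begin
      nonzero-part (x * 0#)      ≡⟨ cong nonzero-part (zeroʳ x) ⟩
      nonzero-part 0#            ≡⟨ cong (if_then 1# else 0#) (≡⇒== {x = 0#} refl) ⟩
      1#                         ≡⟨ *-identityˡ 1# ⟨
      1# * 1#                    ∎
    ... | no  y≢0 with x * y ≟ 0#
    ...   | yes xy≡0 = ⊥-elim (*-≢0 x≢0 y≢0 xy≡0)
    ...   | no  _    = refl

  -- Polynomial functions of degree ≤ e in Horner form P x = c + x · Q x.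
  Polynomial : ℕ → (Carrier → Carrier) → Set
  Polynomial zero    P = ∃ λ c → ∀ x → P x ≡ c
  Polynomial (suc e) P = ∃ λ c → ∃ λ Q → Polynomial e Q × (∀ x → P x ≡ c + x * Q x)

  Monic : ℕ → (Carrier → Carrier) → Set
  Monic zero    P = ∀ x → P x ≡ 1#
  Monic (suc e) P = ∃ λ c → ∃ λ Q → Monic e Q × (∀ x → P x ≡ c + x * Q x)

  monic⇒polynomial : ∀ e {P} → Monic e P → Polynomial e P
  monic⇒polynomial zero    P≡1             = 1# , P≡1
  monic⇒polynomial (suc e) (c , Q , Q-monic , P≡) = c , Q , monic⇒polynomial e Q-monic , P≡

  polynomial-scale : ∀ e {T} r → Polynomial e T → Polynomial e (λ x → r * T x)
  polynomial-scale zero    r (c , T≡c) = r * c , λ x → cong (r *_) (T≡c x)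
  polynomial-scale (suc e) r (c , Q , Q-poly , T≡) =
    r * c , (λ x → r * Q x) , polynomial-scale e r Q-poly , λ x →
      trans (cong (r *_) (T≡ x))
        (solve 4 (λ r c x u → r :* (c :+ x :* u) := r :* c :+ x :* (r :* u)) refl r c x (Q x))

  monic-+ : ∀ e {Q T} → Monic (suc e) Q → Polynomial e T → Monic (suc e) (λ x → Q x + T x)
  monic-+ zero    (c , Q′ , Q′-monic , Q≡) (t , T≡t) =
    c + t , Q′ , Q′-monic , λ x →
      trans (cong₂ _+_ (Q≡ x) (T≡t x))
        (solve 4 (λ c t x u → c :+ x :* u :+ t := c :+ t :+ x :* u) refl c t x (Q′ x))
  monic-+ (suc e) (c , Q′ , Q′-monic , Q≡) (t , T′ , T′-poly , T≡) =
    c + t , (λ x → Q′ x + T′ x) , monic-+ e Q′-monic T′-poly , λ x →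
      trans (cong₂ _+_ (Q≡ x) (T≡ x))
        (solve 5 (λ c t x u v → c :+ x :* u :+ (t :+ x :* v) := c :+ t :+ x :* (u :+ v)) refl c t x (Q′ x) (T′ x))

  factor-theorem : ∀ e {P} → Monic (suc e) P → ∀ r →
                   ∃ λ S → Monic e S × (∀ x → P x ≡ (x - r) * S x + P r)
  factor-theorem zero {P} (c , Q , Q≡1 , P≡) r = (λ _ → 1#) , (λ _ → refl) , λ x → begin
    P x
      ≡⟨ P≡ x ⟩
    c + x * Q x
      ≡⟨ cong (λ u → c + x * u) (Q≡1 x) ⟩
    c + x * 1#
      ≡⟨ cong (λ u → c + u * 1#) (x-y+y≡x x r) ⟨
    c + ((x - r) + r) * 1#
      ≡⟨ solve 3 (λ c d r → c :+ (d :+ r) :* con 1 := d :* con 1 :+ (c :+ r :* con 1)) refl c (x - r) r ⟩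
    (x - r) * 1# + (c + r * 1#)
      ≡⟨ cong (λ u → (x - r) * 1# + (c + r * u)) (Q≡1 r) ⟨
    (x - r) * 1# + (c + r * Q r)
      ≡⟨ cong ((x - r) * 1# +_) (P≡ r) ⟨
    (x - r) * 1# + P r ∎
    where open ≡-Reasoning
  factor-theorem (suc e) {P} (c , Q , Q-monic , P≡) r with factor-theorem e Q-monic r
  ... | S , S-monic , Q≡ =
    (λ x → Q x + r * S x) , monic-+ e Q-monic (polynomial-scale e r (monic⇒polynomial e S-monic)) , λ x → begin
    P x
      ≡⟨ P≡ x ⟩
    c + x * Q x
      ≡⟨ cong (λ u → c + u * Q x) (x-y+y≡x x r) ⟨
    c + ((x - r) + r) * Q x
      ≡⟨ cong (λ u → c + ((x - r) + r) * u) (Q≡ x) ⟩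
    c + ((x - r) + r) * ((x - r) * S x + Q r)
      ≡⟨ solve 5 (λ c d r s b → c :+ (d :+ r) :* (d :* s :+ b) := d :* ((d :* s :+ b) :+ r :* s) :+ (c :+ r :* b))
                 refl c (x - r) r (S x) (Q r) ⟩
    (x - r) * (((x - r) * S x + Q r) + r * S x) + (c + r * Q r)
      ≡⟨ cong₂ (λ u v → (x - r) * (u + r * S x) + v) (Q≡ x) (P≡ r) ⟨
    (x - r) * (Q x + r * S x) + P r ∎
    where open ≡-Reasoning

  card-roots≤degree : ∀ e {P} → Monic e P → card (λ x → P x == 0#) ℕ.≤ e
  card-roots≤degree zero {P} P≡1 =
    ℕₚ.≤-reflexive (trans (card-cong (λ x → ≢⇒==-false (λ P≡0 → 1≢0 (trans (sym (P≡1 x)) P≡0))))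
                          (card-const-false {q}))
  card-roots≤degree (suc e) {P} P-monic with card-witness (λ x → P x == 0#)
  ... | inj₂ none = ℕₚ.≤-trans (ℕₚ.≤-reflexive none) ℕ.z≤n
  ... | inj₁ (r , Pr) with factor-theorem e P-monic r
  ...   | S , S-monic , P≡ =
    ℕₚ.≤-trans (card-mono roots⊆) (ℕₚ.≤-trans (card-∨ (r ==_) (λ x → S x == 0#))
      (ℕₚ.+-mono-≤ (ℕₚ.≤-reflexive (card-singleton r)) (card-roots≤degree e S-monic)))
    where
    open ≡-Reasoning
    roots⊆ : (λ x → P x == 0#) ⊆ (λ x → (r == x) ∨ (S x == 0#))
    roots⊆ x Px with r ≟ x
    ... | yes _ = refl
    ... | no r≢x with S x ≟ 0#
    ...   | yes _   = refl
    ...   | no  S≢0 = ⊥-elim (*-≢0 (λ x-r≡0 → r≢x (sym (x-y≡0⇒x≡y x r x-r≡0))) S≢0 (begin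
      (x - r) * S x             ≡⟨ +-identityʳ _ ⟨
      (x - r) * S x + 0#        ≡⟨ cong ((x - r) * S x +_) (==⇒≡ Pr) ⟨
      (x - r) * S x + P r       ≡⟨ P≡ x ⟨
      P x                       ≡⟨ ==⇒≡ Px ⟩
      0#                        ∎))

  card-roots-of-unity : ∀ t → card (λ y → y ^ᶠ suc t == 1#) ℕ.≤ suc t
  card-roots-of-unity t =
    ℕₚ.≤-trans (ℕₚ.≤-reflexive (card-cong (λ y → ==-⇔ x≡y⇒x-y≡0 (x-y≡0⇒x≡y (y ^ᶠ suc t) 1#))))
               (card-roots≤degree (suc t) y^[1+t]-1-monic)
    where
    x^ᶠ-monic : ∀ e → Monic e (_^ᶠ e)
    x^ᶠ-monic zero    = λ _ → refl
    x^ᶠ-monic (suc e) = 0# , (_^ᶠ e) , x^ᶠ-monic e , λ x → sym (+-identityˡ _)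
    y^[1+t]-1-monic : Monic (suc t) (λ y → y ^ᶠ suc t - 1#)
    y^[1+t]-1-monic = - 1# , (_^ᶠ t) , x^ᶠ-monic t , λ x → +-comm _ _

  μ : ℕ → ℕ
  μ K = card (λ y → y ^ᶠ K == 1#)

  card-^ᶠ-fibre : ∀ K {x₀} → x₀ ≢ 0# → card (λ x → x ^ᶠ K == x₀ ^ᶠ K) ≡ μ K
  card-^ᶠ-fibre K {x₀} x₀≢0 = trans (card-cong same-fibre)
    (card-∘-bijection (λ z → z ^ᶠ K == 1#) (x₀ ⁻¹ *_) (x₀ *_)
                      (λ y → ⁻¹*[x*y]≡y y x₀≢0) (λ x → x*[x⁻¹*y]≡y x x₀≢0))
    where
    w = x₀ ⁻¹ ^ᶠ K
    w≢0 : w ≢ 0#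
    w≢0 = ^ᶠ-≢0 K (⁻¹-≢0 x₀≢0)
    w*x₀^K≡1 : w * x₀ ^ᶠ K ≡ 1#
    w*x₀^K≡1 = trans (sym (*-^ᶠ (x₀ ⁻¹) x₀ K)) (trans (cong (_^ᶠ K) (x⁻¹*x≡1 x₀≢0)) (1^ᶠ≡1 K))
    same-fibre : ∀ x → (x ^ᶠ K == x₀ ^ᶠ K) ≡ ((x₀ ⁻¹ * x) ^ᶠ K == 1#)
    same-fibre x = ==-⇔
      (λ e → trans (*-^ᶠ (x₀ ⁻¹) x K) (trans (cong (w *_) e) w*x₀^K≡1))
      (λ e → *-cancelˡ-≢0 w≢0 (trans (sym (*-^ᶠ (x₀ ⁻¹) x K)) (trans e (sym w*x₀^K≡1))))

  card-^ᶠ-fibre≤μ : ∀ k {y} → y ≢ 0# → card (λ x → x ^ᶠ suc k == y) ℕ.≤ μ (suc k)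
  card-^ᶠ-fibre≤μ k {y} y≢0 with card-witness (λ x → x ^ᶠ suc k == y)
  ... | inj₂ none = ℕₚ.≤-trans (ℕₚ.≤-reflexive none) ℕ.z≤n
  ... | inj₁ (x₀ , x₀^K==y) with ==⇒≡ {x = x₀ ^ᶠ suc k} {y} x₀^K==y
  ...   | refl = ℕₚ.≤-reflexive (card-^ᶠ-fibre (suc k) x₀≢0)
    where
    x₀≢0 : x₀ ≢ 0#
    x₀≢0 refl = y≢0 (0^ᶠsuc≡0 k)

  -- Sort the q - 1 nonzero x by x ^ K: each value is a T-th root of unity (q - 1 = K T)
  -- with at most μ K preimages.
  KT≡q-1⇒K≤μK : ∀ k t → suc k ℕ.* suc t ≡ q ℕ.∸ 1 → suc k ℕ.≤ μ (suc k)
  KT≡q-1⇒K≤μK k t KT≡q-1 = ℕₚ.*-cancelʳ-≤ K (μ K) T (begin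
    K ℕ.* T                                                  ≡⟨ KT≡q-1 ⟩
    q ℕ.∸ 1                                                  ≡⟨ card-nonzero ⟨
    card nonzero                                             ≡⟨ card-cong ≢0⇔root-of-unity ⟩
    sum (λ x → ind (root (x ^ᶠ K)))                          ≡⟨ card-fibres (_^ᶠ K) (ind ∘ root) ⟩
    sum (λ y → ind (root y) ℕ.* card (λ x → x ^ᶠ K == y))    ≤⟨ sum-mono fibre-bound ⟩
    sum (λ y → ind (root y) ℕ.* μ K)                         ≡⟨ sum-cong-≗ (λ y → ℕₚ.*-comm (ind (root y)) (μ K)) ⟩
    sum (λ y → μ K ℕ.* ind (root y))                         ≡⟨ *-distribˡ-sum {q} (μ K) _ ⟨
    μ K ℕ.* card root                                        ≤⟨ ℕₚ.*-monoʳ-≤ (μ K) (card-roots-of-unity t) ⟩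
    μ K ℕ.* T                                                ∎)
    where
    open ℕₚ.≤-Reasoning
    K = suc k
    T = suc t
    root : Carrier → Bool
    root y = y ^ᶠ T == 1#
    ≢0⇔root-of-unity : ∀ x → nonzero x ≡ root (x ^ᶠ K)
    ≢0⇔root-of-unity x with x ≟ 0#
    ... | yes refl = sym (≢⇒==-false λ [0^K]^T≡1 →
                       0≢1 (trans (sym (trans (cong (_^ᶠ T) (0^ᶠsuc≡0 k)) (0^ᶠsuc≡0 t))) [0^K]^T≡1))
    ... | no  x≢0  = sym (≡⇒== (trans (sym (^ᶠ-* x T K))
                       (trans (cong (x ^ᶠ_) (trans (ℕₚ.*-comm T K) KT≡q-1)) (fermat x≢0))))
    fibre-bound : ∀ y → ind (root y) ℕ.* card (λ x → x ^ᶠ K == y) ℕ.≤ ind (root y) ℕ.* μ K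
    fibre-bound y with y ≟ 0#
    ... | yes refl rewrite ≢⇒==-false {x = 0# ^ᶠ T} {1#} (λ 0^T≡1 → 0≢1 (trans (sym (0^ᶠsuc≡0 t)) 0^T≡1))
                   = ℕ.z≤n
    ... | no  y≢0  = ℕₚ.*-monoʳ-≤ (ind (root y)) (card-^ᶠ-fibre≤μ k y≢0)

  nontrivial-root : ℕ → Carrier → Bool
  nontrivial-root K u = (u ^ᶠ K == 1#) ∧ not (u == 1#)

  μ≡1+card-nontrivial-roots : ∀ K → μ K ≡ suc (card (nontrivial-root K))
  μ≡1+card-nontrivial-roots K = trans (card-split (λ u → u ^ᶠ K == 1#) (_== 1#))
    (cong (ℕ._+ card (nontrivial-root K)) (trans (card-cong trivial-root) (card-singleton′ 1#)))
    where
    trivial-root : ∀ u → ((u ^ᶠ K == 1#) ∧ (u == 1#)) ≡ (u == 1#)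
    trivial-root u with u ≟ 1#
    ... | yes refl = trans (cong (_∧ true) (≡⇒== (1^ᶠ≡1 K))) refl
    ... | no  _    = ∧-zeroʳ _

  -- Via w = x⁻¹ and u = 1 + c w (a bijection of the field, sending 0 to 1),
  -- (x + c)^K = x^K becomes u^K = 1 with u ≠ 1.
  card-shift-collisions : ∀ k {c} → c ≢ 0# →
    card (λ x → (x + c) ^ᶠ suc k == x ^ᶠ suc k) ≡ card (nontrivial-root (suc k))
  card-shift-collisions k {c} c≢0 = begin
    card (λ x → (x + c) ^ᶠ K == x ^ᶠ K)
      ≡⟨ card-∘-bijection _ _⁻¹ _⁻¹ ⁻¹-involutive ⁻¹-involutive ⟨
    card (λ w → (w ⁻¹ + c) ^ᶠ K == w ⁻¹ ^ᶠ K)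
      ≡⟨ card-cong (λ w → collision⇔root w (w ≟ 0#)) ⟩
    card (λ w → nontrivial-root K (1# + c * w))
      ≡⟨ card-∘-bijection (nontrivial-root K) affine affine⁻¹ affine∘affine⁻¹ affine⁻¹∘affine ⟩
    card (nontrivial-root K) ∎
    where
    open ≡-Reasoning
    K = suc k
    affine affine⁻¹ : Carrier → Carrier
    affine   w = 1# + c * w
    affine⁻¹ u = c ⁻¹ * (u - 1#)
    affine∘affine⁻¹ : ∀ u → affine (affine⁻¹ u) ≡ u
    affine∘affine⁻¹ u = trans (cong (1# +_) (x*[x⁻¹*y]≡y (u - 1#) c≢0)) (trans (+-comm 1# _) (x-y+y≡x u 1#))
    affine⁻¹∘affine : ∀ w → affine⁻¹ (affine w) ≡ w
    affine⁻¹∘affine w = begin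
      c ⁻¹ * (1# + c * w - 1#)     ≡⟨ cong (λ v → c ⁻¹ * (v - 1#)) (+-comm 1# _) ⟩
      c ⁻¹ * (c * w + 1# - 1#)     ≡⟨ cong (c ⁻¹ *_) (x+y-y≡x (c * w) 1#) ⟩
      c ⁻¹ * (c * w)               ≡⟨ ⁻¹*[x*y]≡y w c≢0 ⟩
      w                            ∎
    collision⇔root : ∀ w → Dec (w ≡ 0#) → ((w ⁻¹ + c) ^ᶠ K == w ⁻¹ ^ᶠ K) ≡ nontrivial-root K (1# + c * w)
    collision⇔root w (yes refl) = begin
      ((0# ⁻¹ + c) ^ᶠ K == 0# ⁻¹ ^ᶠ K)   ≡⟨ ≢⇒==-false c^K≢0^K ⟩
      false                             ≡⟨ ∧-zeroʳ _ ⟨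
      (1# ^ᶠ K == 1#) ∧ false           ≡⟨ cong (λ b → (1# ^ᶠ K == 1#) ∧ not b) (≡⇒== {x = 1#} refl) ⟨
      nontrivial-root K 1#              ≡⟨ cong (nontrivial-root K) 1+c*0≡1 ⟨
      nontrivial-root K (1# + c * 0#)   ∎
      where
      1+c*0≡1 : 1# + c * 0# ≡ 1#
      1+c*0≡1 = trans (cong (1# +_) (zeroʳ c)) (+-identityʳ 1#)
      c^K≢0^K : (0# ⁻¹ + c) ^ᶠ K ≢ 0# ⁻¹ ^ᶠ K
      c^K≢0^K e = ^ᶠ-≢0 K c≢0 (begin
        c ^ᶠ K                  ≡⟨ cong (_^ᶠ K) (trans (cong (_+ c) 0⁻¹≡0) (+-identityˡ c)) ⟨
        (0# ⁻¹ + c) ^ᶠ K        ≡⟨ e ⟩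
        0# ⁻¹ ^ᶠ K              ≡⟨ cong (_^ᶠ K) 0⁻¹≡0 ⟩
        0# ^ᶠ K                 ≡⟨ 0^ᶠsuc≡0 k ⟩
        0#                      ∎)
    collision⇔root w (no w≢0) =
      trans (==-⇔ to from)
        (sym (trans (cong (λ b → ((1# + c * w) ^ᶠ K == 1#) ∧ not b) (≢⇒==-false 1+cw≢1)) (∧-identityʳ _)))
      where
      1+cw≢1 : 1# + c * w ≢ 1#
      1+cw≢1 e = *-≢0 c≢0 w≢0 (+-cancelˡ 1# _ 0# (trans e (sym (+-identityʳ 1#))))
      v = w ^ᶠ K
      v*lhs : v * (w ⁻¹ + c) ^ᶠ K ≡ (1# + c * w) ^ᶠ K
      v*lhs = trans (sym (*-^ᶠ w _ K))
                    (cong (_^ᶠ K) (trans (distribˡ w (w ⁻¹) c) (cong₂ _+_ (x*x⁻¹≡1 w≢0) (*-comm w c))))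
      v*rhs : v * w ⁻¹ ^ᶠ K ≡ 1#
      v*rhs = trans (sym (*-^ᶠ w _ K)) (trans (cong (_^ᶠ K) (x*x⁻¹≡1 w≢0)) (1^ᶠ≡1 K))
      to : (w ⁻¹ + c) ^ᶠ K ≡ w ⁻¹ ^ᶠ K → (1# + c * w) ^ᶠ K ≡ 1#
      to e = trans (sym v*lhs) (trans (cong (v *_) e) v*rhs)
      from : (1# + c * w) ^ᶠ K ≡ 1# → (w ⁻¹ + c) ^ᶠ K ≡ w ⁻¹ ^ᶠ K
      from e = *-cancelˡ-≢0 (^ᶠ-≢0 K w≢0) (trans v*lhs (trans e (sym v*rhs)))

module DembowskiOstrom {p n : ℕ} (F : FiniteField p n) (p-prime : Prime p)
                       (f : Fin (p ^ n) → Fin (p ^ n)) (f-DO : FiniteField.IsDO F f) where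

  open import Data.Fin.Base using (zero; suc; toℕ)
  open import Data.Nat.Base as ℕ using ()
  open import Data.Product.Base using (proj₁; proj₂)
  open import Function.Base using (_∘_)
  open import Relation.Binary.PropositionalEquality
  open FieldTheory
  open FieldArithmetic F
  open Frobenius F p-prime using (frobenius-^)
  open import Algebra.Properties.CommutativeMonoid.Sum +-commutativeMonoid
    using (sum-cong-≗; ∑-distrib-+) renaming (sum to sumᶠ)

  private
    ∑≡sumᶠ : ∀ {k} (g : Fin k → Carrier) → ∑ g ≡ sumᶠ g
    ∑≡sumᶠ {ℕ.zero}  g = refl
    ∑≡sumᶠ {ℕ.suc k} g = cong (g zero +_) (∑≡sumᶠ (g ∘ suc))

    ∑-cong : ∀ {k} {g h : Fin k → Carrier} → (∀ i → g i ≡ h i) → ∑ g ≡ ∑ h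
    ∑-cong {g = g} {h} g≗h = trans (∑≡sumᶠ g) (trans (sum-cong-≗ g≗h) (sym (∑≡sumᶠ h)))

    ∑-+ : ∀ {k} (g h : Fin k → Carrier) → ∑ (λ i → g i + h i) ≡ ∑ g + ∑ h
    ∑-+ {k} g h = trans (∑≡sumᶠ (λ i → g i + h i))
                        (trans (∑-distrib-+ {k} g h) (sym (cong₂ _+_ (∑≡sumᶠ g) (∑≡sumᶠ h))))

    ∑-+-+ : ∀ {k} (g h l : Fin k → Carrier) → ∑ (λ i → g i + h i + l i) ≡ ∑ g + ∑ h + ∑ l
    ∑-+-+ g h l = trans (∑-+ (λ i → g i + h i) l) (cong (_+ ∑ l) (∑-+ g h))

  a : Fin n → Fin n → Carrier
  a = proj₁ f-DO

  e : Fin n → ℕ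
  e i = p ℕ.^ toℕ i

  monomial : Carrier → Fin n → Fin n → Carrier
  monomial x i j = a i j * x ^ᶠ (e i ℕ.+ e j)

  f≡ : ∀ x → f x ≡ ∑ (λ i → ∑ (monomial x i))
  f≡ = proj₂ (proj₂ f-DO)

  cross : Carrier → Carrier → Fin n → Fin n → Carrier
  cross x y i j = a i j * (x ^ᶠ e i * y ^ᶠ e j + y ^ᶠ e i * x ^ᶠ e j)

  polar : Carrier → Carrier → Carrier
  polar x y = ∑ (λ i → ∑ (cross x y i))

  -- Each x ↦ x ^ e i is additive (Frobenius), so each monomial is a product of two additive maps.
  monomial-+ : ∀ x y i j → monomial (x + y) i j ≡ monomial x i j + monomial y i j + cross x y i j
  monomial-+ x y i j = begin
    a i j * (x + y) ^ᶠ (e i ℕ.+ e j)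
      ≡⟨ cong (a i j *_) (^ᶠ-+ (x + y) (e i) (e j)) ⟩
    a i j * ((x + y) ^ᶠ e i * (x + y) ^ᶠ e j)
      ≡⟨ cong₂ (λ u v → a i j * (u * v)) (frobenius-^ (toℕ i) x y) (frobenius-^ (toℕ j) x y) ⟩
    a i j * ((x ^ᶠ e i + y ^ᶠ e i) * (x ^ᶠ e j + y ^ᶠ e j))
      ≡⟨ solve 5 (λ c a b u v → c :* ((a :+ b) :* (u :+ v))
                             := c :* (a :* u) :+ c :* (b :* v) :+ c :* (a :* v :+ b :* u))
                 refl (a i j) (x ^ᶠ e i) (y ^ᶠ e i) (x ^ᶠ e j) (y ^ᶠ e j) ⟩
    a i j * (x ^ᶠ e i * x ^ᶠ e j) + a i j * (y ^ᶠ e i * y ^ᶠ e j) + cross x y i j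
      ≡⟨ cong₂ (λ u v → a i j * u + a i j * v + cross x y i j) (^ᶠ-+ x (e i) (e j)) (^ᶠ-+ y (e i) (e j)) ⟨
    monomial x i j + monomial y i j + cross x y i j ∎
    where open ≡-Reasoning

  f-+ : ∀ x y → f (x + y) ≡ f x + f y + polar x y
  f-+ x y = begin
    f (x + y)
      ≡⟨ f≡ (x + y) ⟩
    ∑ (λ i → ∑ (monomial (x + y) i))
      ≡⟨ ∑-cong (λ i → trans (∑-cong (monomial-+ x y i)) (∑-+-+ {n} _ _ _)) ⟩
    ∑ (λ i → ∑ (monomial x i) + ∑ (monomial y i) + ∑ (cross x y i))
      ≡⟨ ∑-+-+ {n} _ _ _ ⟩
    ∑ (λ i → ∑ (monomial x i)) + ∑ (λ i → ∑ (monomial y i)) + polar x y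
      ≡⟨ cong₂ (λ u v → u + v + polar x y) (f≡ x) (f≡ y) ⟨
    f x + f y + polar x y ∎
    where open ≡-Reasoning

  cross-+ˡ : ∀ x z y i j → cross (x + z) y i j ≡ cross x y i j + cross z y i j
  cross-+ˡ x z y i j = trans
    (cong₂ (λ u v → a i j * (u * y ^ᶠ e j + y ^ᶠ e i * v)) (frobenius-^ (toℕ i) x z) (frobenius-^ (toℕ j) x z))
    (solve 7 (λ c a b u v s t → c :* ((a :+ b) :* s :+ t :* (u :+ v))
                             := c :* (a :* s :+ t :* u) :+ c :* (b :* s :+ t :* v))
           refl (a i j) (x ^ᶠ e i) (z ^ᶠ e i) (x ^ᶠ e j) (z ^ᶠ e j) (y ^ᶠ e j) (y ^ᶠ e i))

  polar-+ˡ : ∀ x z y → polar (x + z) y ≡ polar x y + polar z y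
  polar-+ˡ x z y = trans (∑-cong (λ i → trans (∑-cong (cross-+ˡ x z y i)) (∑-+ {n} _ _))) (∑-+ {n} _ _)

  difference≡ : ∀ c x → f (x + c) - f x ≡ f c + polar x c
  difference≡ c x = begin
    f (x + c) - f x
      ≡⟨ cong (_- f x) (f-+ x c) ⟩
    f x + f c + polar x c - f x
      ≡⟨ cong (_- f x) (solve 3 (λ a b c → a :+ b :+ c := b :+ c :+ a) refl (f x) (f c) (polar x c)) ⟩
    f c + polar x c + f x - f x
      ≡⟨ x+y-y≡x _ (f x) ⟩
    f c + polar x c ∎
    where open ≡-Reasoning

  difference-+ : ∀ c x y → f (x + y + c) - f (x + y) ≡ (f (x + c) - f x) + polar y c
  difference-+ c x y = begin
    f (x + y + c) - f (x + y)          ≡⟨ difference≡ c (x + y) ⟩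
    f c + polar (x + y) c              ≡⟨ cong (f c +_) (polar-+ˡ x y c) ⟩
    f c + (polar x c + polar y c)      ≡⟨ +-assoc (f c) _ _ ⟨
    f c + polar x c + polar y c        ≡⟨ cong (_+ polar y c) (difference≡ c x) ⟨
    (f (x + c) - f x) + polar y c      ∎
    where open ≡-Reasoning

module AffineMap {p n : ℕ} (F : FiniteField p n) (g L : Fin (p ^ n) → Fin (p ^ n))
                 (g-+ : ∀ x y → g (FiniteField._+_ F x y) ≡ FiniteField._+_ F (g x) (L y)) where

  open import Data.Bool.Base using (Bool)
  open import Data.Nat.Base as ℕ using ()
  import Data.Nat.Properties as ℕₚ
  open import Data.Nat.Divisibility using (_∣0; ∣-reflexive)
  open import Data.Sum.Base using (inj₁; inj₂)
  open import Relation.Binary.PropositionalEquality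
  open Counting
  open FieldTheory.FieldArithmetic F

  kernel : Carrier → Bool
  kernel y = L y == 0#

  card-fibre≡card-kernel : ∀ {b x₁} → g x₁ ≡ b → card (λ x → g x == b) ≡ card kernel
  card-fibre≡card-kernel {b} {x₁} gx₁≡b = begin
    card (λ x → g x == b)          ≡⟨ card-∘-bijection (λ x → g x == b) (x₁ +_) (_- x₁) x₁+[y-x₁]≡y [x₁+x]-x₁≡x ⟨
    card (λ y → g (x₁ + y) == b)   ≡⟨ card-cong (λ y → ==-⇔ (to y) (from y)) ⟩
    card kernel                    ∎
    where
    open ≡-Reasoning
    x₁+[y-x₁]≡y : ∀ y → x₁ + (y - x₁) ≡ y
    x₁+[y-x₁]≡y y = trans (+-comm x₁ _) (x-y+y≡x y x₁)
    [x₁+x]-x₁≡x : ∀ x → x₁ + x - x₁ ≡ x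
    [x₁+x]-x₁≡x x = trans (cong (_- x₁) (+-comm x₁ x)) (x+y-y≡x x x₁)
    g[x₁+y]≡b+Ly : ∀ y → g (x₁ + y) ≡ b + L y
    g[x₁+y]≡b+Ly y = trans (g-+ x₁ y) (cong (_+ L y) gx₁≡b)
    to : ∀ y → g (x₁ + y) ≡ b → L y ≡ 0#
    to y e = +-cancelˡ b (L y) 0# (trans (sym (g[x₁+y]≡b+Ly y)) (trans e (sym (+-identityʳ b))))
    from : ∀ y → L y ≡ 0# → g (x₁ + y) ≡ b
    from y Ly≡0 = trans (g[x₁+y]≡b+Ly y) (trans (cong (b +_) Ly≡0) (+-identityʳ b))

  -- The fibres of g partition the q points, and each fibre is empty or a coset of the kernel.
  card-kernel∣q : card kernel ∣ p ℕ.^ n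
  card-kernel∣q = subst (card kernel ∣_) q≡Σfibres (∣-sum _ fibre-divisible)
    where
    q≡Σfibres : sum (λ b → 1 ℕ.* card (λ x → g x == b)) ≡ p ℕ.^ n
    q≡Σfibres = trans (sym (card-fibres g (λ _ → 1))) card-const-true
    fibre-divisible : ∀ b → card kernel ∣ 1 ℕ.* card (λ x → g x == b)
    fibre-divisible b with card-witness (λ x → g x == b)
    ... | inj₁ (x₁ , gx₁==b) = ∣-reflexive (sym (trans (ℕₚ.+-identityʳ _) (card-fibre≡card-kernel (==⇒≡ gx₁==b))))
    ... | inj₂ empty         = subst (card kernel ∣_) (sym (trans (ℕₚ.+-identityʳ _) empty)) (_ ∣0)

  image-subspace : ∀ {x₀} → g x₀ ≡ 0# → IsFpSubspace (λ y → ∃ λ x → g x ≡ y)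
  image-subspace {x₀} gx₀≡0 = (x₀ , gx₀≡0) , +-closed , ·1-closed
    where
    +-closed : ∀ y z → (∃ λ x → g x ≡ y) → (∃ λ x → g x ≡ z) → ∃ λ x → g x ≡ y + z
    +-closed y z (x , gx≡y) (x′ , gx′≡z) = x + (x′ - x₀) , (begin
      g (x + (x′ - x₀))        ≡⟨ g-+ x (x′ - x₀) ⟩
      g x + L (x′ - x₀)        ≡⟨ cong (g x +_) Lx′-x₀≡gx′ ⟩
      g x + g x′               ≡⟨ cong₂ _+_ gx≡y gx′≡z ⟩
      y + z                    ∎)
      where
      open ≡-Reasoning
      Lx′-x₀≡gx′ : L (x′ - x₀) ≡ g x′
      Lx′-x₀≡gx′ = begin
        L (x′ - x₀)             ≡⟨ +-identityˡ _ ⟨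
        0# + L (x′ - x₀)        ≡⟨ cong (_+ L (x′ - x₀)) gx₀≡0 ⟨
        g x₀ + L (x′ - x₀)      ≡⟨ g-+ x₀ (x′ - x₀) ⟨
        g (x₀ + (x′ - x₀))      ≡⟨ cong g (trans (+-comm x₀ _) (x-y+y≡x x′ x₀)) ⟩
        g x′                    ∎
    ·1-closed : ∀ m y → (∃ λ x → g x ≡ y) → ∃ λ x → g x ≡ (m ·1) * y
    ·1-closed ℕ.zero    y _    = x₀ , trans gx₀≡0 (sym (zeroˡ y))
    ·1-closed (ℕ.suc m) y y∈im =
      subst (λ z → ∃ λ x → g x ≡ z) (sym (·1-suc-* m y)) (+-closed y _ y∈im (·1-closed m y y∈im))

module DivisibleAlmostToOne {p n d : ℕ} (F : FiniteField p n) (K∣q-1 : suc d ∣ p ^ n ∸ 1)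
    (f : Fin (p ^ n) → Fin (p ^ n))
    (f-divisible : FiniteField.IsDivisible F (suc d) f)
    (f-almost : FiniteField.IsAlmostKTo1 F (suc d) f) where

  open import Data.Bool.Base using (true)
  open import Data.Empty using (⊥-elim)
  open import Data.Fin.Properties using (_≟_)
  open import Data.Nat.Base as ℕ using (zero; _≤_)
  import Data.Nat.Properties as ℕₚ
  open import Data.Nat.Divisibility using (divides)
  open import Data.Product.Base using (proj₁; proj₂)
  open import Function.Base using (_∘_)
  open import Relation.Nullary.Decidable using (yes; no)
  open import Relation.Binary.PropositionalEquality
  open Counting
  open FieldTheory.FieldArithmetic F
  open RootCounting F

  private
    K = suc d
    f′ = proj₁ f-divisible
    f≡f′∘^K = proj₂ f-divisible
    y₀ = proj₁ f-almost
    count-y₀≡1 = proj₁ (proj₂ f-almost)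
    count≡1⇒≡y₀ = proj₁ (proj₂ (proj₂ f-almost))
    count≡K = proj₂ (proj₂ (proj₂ f-almost))

  count≡card : ∀ (g : Carrier → Carrier) y → count g y ≡ card (λ x → g x == y)
  count≡card = length-filter≡card _≟_

  1≤count-f[fx] : ∀ x → 1 ≤ count f (f x)
  1≤count-f[fx] x = subst (1 ≤_) (sym (count≡card f (f x)))
    (ℕₚ.≤-trans (ℕₚ.≤-reflexive (sym (card-singleton x)))
                (card-mono {C = λ z → f z == f x} (λ z x==z → ≡⇒== (cong f (sym (==⇒≡ x==z))))))

  -- For d = 0 every value would have exactly one preimage, so f would be constant with value y₀.
  1≤d : 1 ≤ d
  1≤d = ℕₚ.n≢0⇒n>0 d≢0
    where
    d≢0 : d ≢ 0
    d≢0 d≡0 = ℕₚ.<⇒≢ 2≤q (begin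
      1                          ≡⟨ count-y₀≡1 ⟨
      count f y₀                 ≡⟨ count≡card f y₀ ⟩
      card (λ x → f x == y₀)     ≡⟨ card-cong (λ x → ≡⇒== (f≡y₀ x)) ⟩
      card {q} (λ _ → true)      ≡⟨ card-const-true ⟩
      q                          ∎)
      where
      open ≡-Reasoning
      f≡y₀ : ∀ x → f x ≡ y₀
      f≡y₀ x with f x ≟ y₀
      ... | yes fx≡y₀ = fx≡y₀
      ... | no  fx≢y₀ = count≡1⇒≡y₀ (f x) (trans (count≡K (f x) fx≢y₀ (1≤count-f[fx] x)) (cong suc d≡0))

  K≤μK : K ≤ μ K
  K≤μK = from-quotient K∣q-1
    where
    from-quotient : K ∣ q ℕ.∸ 1 → K ≤ μ K
    from-quotient (divides (suc t) q-1≡[1+t]K) = KT≡q-1⇒K≤μK d t (trans (ℕₚ.*-comm K (suc t)) (sym q-1≡[1+t]K))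
    from-quotient (divides zero    q-1≡0)      =
      ⊥-elim (ℕₚ.<⇒≢ (ℕₚ.<-≤-trans (ℕ.s≤s ℕ.z≤n) (ℕₚ.∸-monoˡ-≤ 1 2≤q)) (sym q-1≡0))

  ^K≡⇒f≡ : ∀ {x z} → z ^ᶠ K ≡ x ^ᶠ K → f z ≡ f x
  ^K≡⇒f≡ {x} {z} z^K≡x^K = trans (f≡f′∘^K z) (trans (cong f′ z^K≡x^K) (sym (f≡f′∘^K x)))

  ^K-fibre⊆f-fibre : ∀ x → (λ z → z ^ᶠ K == x ^ᶠ K) ⊆ (λ z → f z == f x)
  ^K-fibre⊆f-fibre x z z^K==x^K = ≡⇒== (^K≡⇒f≡ (==⇒≡ {x = z ^ᶠ K} {x ^ᶠ K} z^K==x^K))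

  μK≤count-f[fx] : ∀ {x} → x ≢ 0# → μ K ≤ count f (f x)
  μK≤count-f[fx] {x} x≢0 = begin
    μ K                                ≡⟨ card-^ᶠ-fibre K x≢0 ⟨
    card (λ z → z ^ᶠ K == x ^ᶠ K)      ≤⟨ card-mono (^K-fibre⊆f-fibre x) ⟩
    card (λ z → f z == f x)            ≡⟨ count≡card f (f x) ⟨
    count f (f x)                      ∎
    where open ℕₚ.≤-Reasoning

  -- The fibre through x ≠ 0 has at least μ K ≥ K ≥ 2 points, so it is not the singleton fibre.
  count-f[fx]≡K : ∀ {x} → x ≢ 0# → count f (f x) ≡ K
  count-f[fx]≡K {x} x≢0 = count≡K (f x) fx≢y₀ (1≤count-f[fx] x)
    where
    fx≢y₀ : f x ≢ y₀
    fx≢y₀ fx≡y₀ = ℕₚ.<⇒≢ (ℕₚ.<-≤-trans (ℕ.s≤s 1≤d) (ℕₚ.≤-trans K≤μK (μK≤count-f[fx] x≢0)))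
                         (sym (trans (cong (count f) fx≡y₀) count-y₀≡1))

  μK≡K : μ K ≡ K
  μK≡K = ℕₚ.≤-antisym (subst (μ K ≤_) (count-f[fx]≡K 1≢0) (μK≤count-f[fx] 1≢0)) K≤μK

  f≡⇒^K≡ : ∀ {x z} → x ≢ 0# → f z ≡ f x → z ^ᶠ K ≡ x ^ᶠ K
  f≡⇒^K≡ {x} {z} x≢0 fz≡fx =
    ==⇒≡ (⊆∧card≡⇒⊇ _ _ (^K-fibre⊆f-fibre x) fibres-equinumerous z (≡⇒== fz≡fx))
    where
    fibres-equinumerous : card (λ z → z ^ᶠ K == x ^ᶠ K) ≡ card (λ z → f z == f x)
    fibres-equinumerous = begin
      card (λ z → z ^ᶠ K == x ^ᶠ K)    ≡⟨ card-^ᶠ-fibre K x≢0 ⟩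
      μ K                              ≡⟨ μK≡K ⟩
      K                                ≡⟨ count-f[fx]≡K x≢0 ⟨
      count f (f x)                    ≡⟨ count≡card f (f x) ⟩
      card (λ z → f z == f x)          ∎
      where open ≡-Reasoning

  f-collision⇒^K-collision : ∀ {c} → c ≢ 0# → ∀ x → f (x + c) ≡ f x → (x + c) ^ᶠ K ≡ x ^ᶠ K
  f-collision⇒^K-collision {c} c≢0 x f[x+c]≡fx with x ≟ 0#
  ... | no  x≢0  = f≡⇒^K≡ x≢0 f[x+c]≡fx
  ... | yes refl = ⊥-elim (^ᶠ-≢0 K c≢0 (sym (trans (sym (0^ᶠsuc≡0 d)) 0^K≡c^K)))
    where
    0^K≡c^K : 0# ^ᶠ K ≡ c ^ᶠ K
    0^K≡c^K = f≡⇒^K≡ c≢0 (sym (trans (cong f (sym (+-identityˡ c))) f[x+c]≡fx))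

  δ[c,0]≡d : ∀ {c} → c ≢ 0# → δ f c 0# ≡ d
  δ[c,0]≡d {c} c≢0 = begin
    δ f c 0#
      ≡⟨ count≡card (λ x → f (x + c) - f x) 0# ⟩
    card (λ x → f (x + c) - f x == 0#)
      ≡⟨ card-cong (λ x → ==-⇔ (f-collision⇒^K-collision c≢0 x ∘ x-y≡0⇒x≡y _ _) (x≡y⇒x-y≡0 ∘ ^K≡⇒f≡)) ⟩
    card (λ x → (x + c) ^ᶠ K == x ^ᶠ K)
      ≡⟨ card-shift-collisions d c≢0 ⟩
    card (nontrivial-root K)
      ≡⟨ ℕₚ.suc-injective (trans (sym (μ≡1+card-nontrivial-roots K)) μK≡K) ⟩
    d ∎
    where open ≡-Reasoning

module DifferentialStructure {p n d : ℕ} (p-prime : Prime p) (K∣q-1 : suc d ∣ p ^ n ∸ 1)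
    (F : FiniteField p n) (f : Fin (p ^ n) → Fin (p ^ n))
    (f-divisible : FiniteField.IsDivisible F (suc d) f) (f-DO : FiniteField.IsDO F f)
    (f-almost : FiniteField.IsAlmostKTo1 F (suc d) f) where

  open import Data.Bool.Base using (true)
  open import Data.Nat.Base using (_≤_; z≤n)
  import Data.Nat.Properties as ℕₚ
  open import Data.Product.Base using (proj₁; proj₂)
  open import Data.Sum.Base using (_⊎_; inj₁; inj₂)
  open import Relation.Binary.PropositionalEquality using (subst; trans; sym)
  open PrimePowers using (∣p^n⇒≡p^i)
  open Counting
  open FieldTheory.FieldArithmetic F
  open DivisibleAlmostToOne F K∣q-1 f f-divisible f-almost public using (δ[c,0]≡d)
  open DivisibleAlmostToOne F K∣q-1 f f-divisible f-almost using (count≡card; 1≤d)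
  open DembowskiOstrom F p-prime f f-DO using (polar; difference-+)

  Δ : Carrier → Carrier → Carrier
  Δ c x = f (x + c) - f x

  module Δ (c : Carrier) = AffineMap F (Δ c) (λ y → polar y c) (difference-+ c)

  zero-difference : ∀ {c} → c ≢ 0# → ∃ λ x₀ → f (x₀ + c) - f x₀ ≡ 0#
  zero-difference {c} c≢0 = x₀ , ==⇒≡ {x = Δ c x₀} {0#} Δx₀==0
    where
    card≡d : card (λ x → Δ c x == 0#) ≡ d
    card≡d = trans (sym (count≡card (Δ c) 0#)) (δ[c,0]≡d c≢0)
    witness = card-pos⇒witness (λ x → Δ c x == 0#) (subst (1 ≤_) (sym card≡d) 1≤d)
    x₀ = proj₁ witness
    Δx₀==0 = proj₂ witness

  card-kernel≡d : ∀ {c} → c ≢ 0# → card (Δ.kernel c) ≡ d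
  card-kernel≡d {c} c≢0 = trans (sym (Δ.card-fibre≡card-kernel c (proj₂ (zero-difference c≢0))))
                                (trans (sym (count≡card (Δ c) 0#)) (δ[c,0]≡d c≢0))

  δ≤d : ∀ c b → c ≢ 0# → δ f c b ≤ d
  δ≤d c b c≢0 = bound (card-witness (λ x → Δ c x == b))
    where
    bound : (∃ λ x → (Δ c x == b) ≡ true) ⊎ card (λ x → Δ c x == b) ≡ 0 → δ f c b ≤ d
    bound (inj₁ (x₁ , x₁==b)) = ℕₚ.≤-reflexive (trans (count≡card (Δ c) b)
      (trans (Δ.card-fibre≡card-kernel c (==⇒≡ {x = Δ c x₁} {b} x₁==b)) (card-kernel≡d c≢0)))
    bound (inj₂ empty) = subst (_≤ d) (sym (trans (count≡card (Δ c) b) empty)) z≤n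

  differential-set-subspace : ∀ c → c ≢ 0# → IsFpSubspace (D f c)
  differential-set-subspace c c≢0 = Δ.image-subspace c (proj₂ (zero-difference c≢0))

  d≡p^i : ∃ λ i → d ≡ p ^ i
  d≡p^i = ∣p^n⇒≡p^i p-prime n (subst (_∣ p ^ n) (card-kernel≡d 1≢0) (Δ.card-kernel∣q 1#))

lemma3p1 : (p n d : ℕ) → Prime p → suc d ∣ (p ^ n ∸ 1) →
    (F : FiniteField p n) → (f : Fin (p ^ n) → Fin (p ^ n)) →
    FiniteField.IsDivisible F (suc d) f → FiniteField.IsDO F f →
    FiniteField.IsAlmostKTo1 F (suc d) f →
    FiniteField.IsZDB F d f ×
    (FiniteField.IsDiffUniform F d f ×
      (∀ a → a ≢ FiniteField.0# F → FiniteField.IsFpSubspace F (FiniteField.D F f a))) ×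
    (∃ λ i → d ≡ p ^ i)
lemma3p1 p n d p-prime K∣q-1 F f f-divisible f-DO f-almost =
  (λ c c≢0 → δ[c,0]≡d c≢0) ,
  ((δ≤d , (1# , 0# , 1≢0 , δ[c,0]≡d 1≢0)) , differential-set-subspace) ,
  d≡p^i
  where
  open FieldTheory.FieldArithmetic F using (0#; 1#; 1≢0)
  open DifferentialStructure p-prime K∣q-1 F f f-divisible f-DO f-almost
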